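{- Let $G$ be a PCA graph and let $v,w\in V(G)$ be non-adjacent. If $G\cup\{vw\}$ is a PCA graph that is not a proper interval graph and is not co-connected, and $G\setminus\{v\}$ is co-connected, then $v$ is universal in $G\cup\{vw\}$ and $G$ is co-bipartite.
   Context: A PCA graph is an intersection graph of arcs of a circle none of which properly contains another; a proper interval graph is an intersection graph of intervals of the real line none of which properly contains another. $G\cup\{vw\}$ is $G$ with the edge $vw$ added. A graph is co-connected if its complement is connected and co-bipartite if its complement is bipartite. A vertex is universal if adjacent to all other vertices. -}

module Defs where

open import Data.Nat using (ℕ; _≤_; _+_; _∸_; _%_; NonZero)
open import Data.Fin using (Fin; toℕ)
open import Data.Bool using (Bool)
open import Data.Product using (Σ; ∃; _×_; _,_)
open import Data.Sum using (_⊎_)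
open import Relation.Nullary using (¬_)
open import Relation.Binary.PropositionalEquality using (_≡_; _≢_)
open import Relation.Binary.Construct.Closure.ReflexiveTransitive using (Star)

record Graph (V : Set) : Set₁ where
  field
    Adj    : V → V → Set
    sym    : ∀ {x y} → Adj x y → Adj y x
    irrefl : ∀ {x} → ¬ Adj x x
open Graph public

addEdge : ∀ {V} → Graph V → (v w : V) → v ≢ w → Graph V
addEdge G v w v≢w = record
  { Adj    = λ x y → Adj G x y ⊎ ((x ≡ v × y ≡ w) ⊎ (x ≡ w × y ≡ v))
  ; sym    = symm
  ; irrefl = irr
  }
  where
  open import Data.Sum using (inj₁; inj₂)
  open import Relation.Binary.PropositionalEquality using (refl)
  symm : ∀ {x y} → Adj G x y ⊎ ((x ≡ v × y ≡ w) ⊎ (x ≡ w × y ≡ v))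
               → Adj G y x ⊎ ((y ≡ v × x ≡ w) ⊎ (y ≡ w × x ≡ v))
  symm (inj₁ a) = inj₁ (sym G a)
  symm (inj₂ (inj₁ (p , q))) = inj₂ (inj₂ (q , p))
  symm (inj₂ (inj₂ (p , q))) = inj₂ (inj₁ (q , p))
  irr : ∀ {x} → ¬ (Adj G x x ⊎ ((x ≡ v × x ≡ w) ⊎ (x ≡ w × x ≡ v)))
  irr (inj₁ a) = irrefl G a
  irr (inj₂ (inj₁ (refl , refl))) = v≢w refl
  irr (inj₂ (inj₂ (refl , refl))) = v≢w refl

deleteVertex : ∀ {V} → Graph V → (v : V) → Graph (Σ V (λ u → u ≢ v))
deleteVertex G v = record
  { Adj    = λ { (x , _) (y , _) → Adj G x y }
  ; sym    = λ {x} {y} a → sym G a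
  ; irrefl = λ {x} a → irrefl G a
  }

complement : ∀ {V} → Graph V → Graph V
complement G = record
  { Adj    = λ x y → x ≢ y × ¬ Adj G x y
  ; sym    = λ { (x≢y , n) → (λ e → x≢y (Eq.sym e)) , (λ a → n (sym G a)) }
  ; irrefl = λ { (x≢x , _) → x≢x Eq.refl }
  }
  where import Relation.Binary.PropositionalEquality as Eq

Connected : ∀ {V} → Graph V → Set
Connected G = ∀ x y → Star (Adj G) x y

Bipartite : ∀ {V} → Graph V → Set
Bipartite {V} G = Σ (V → Bool) λ c → ∀ {x y} → Adj G x y → c x ≢ c y

CoConnected : ∀ {V} → Graph V → Set
CoConnected G = Connected (complement G)

CoBipartite : ∀ {V} → Graph V → Set
CoBipartite G = Bipartite (complement G)

Universal : ∀ {V} → Graph V → V → Set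
Universal G v = ∀ u → u ≢ v → Adj G u v

-- Intersection models.  Closed arcs/intervals with integer endpoints
-- (every finite model can be normalised to such one).

-- Closed arc on a circle of circumference L (points 0..L-1, cyclically):
-- starts at `start`, covers the points start, start+1, ..., start+len (mod L).
record Arc (L : ℕ) : Set where
  constructor arc
  field
    start : Fin L
    len   : ℕ

_∈Arc_ : ∀ {L} .{{_ : NonZero L}} → Fin L → Arc L → Set
_∈Arc_ {L} p (arc s ℓ) = ((toℕ p + L) ∸ toℕ s) % L ≤ ℓ

ArcsIntersect : ∀ {L} .{{_ : NonZero L}} → Arc L → Arc L → Set
ArcsIntersect {L} A B = ∃ λ (p : Fin L) → p ∈Arc A × p ∈Arc B

ArcContains : ∀ {L} .{{_ : NonZero L}} → Arc L → Arc L → Set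
ArcContains {L} A B = ∀ (p : Fin L) → p ∈Arc B → p ∈Arc A

ArcProperlyContains : ∀ {L} .{{_ : NonZero L}} → Arc L → Arc L → Set
ArcProperlyContains A B = ArcContains A B × ¬ ArcContains B A

record PCAModel {V} (G : Graph V) : Set where
  field
    L        : ℕ
    {{L≢0}}  : NonZero L
    arcOf    : V → Arc L
    model    : ∀ x y → x ≢ y → (Adj G x y → ArcsIntersect (arcOf x) (arcOf y))
                               × (ArcsIntersect (arcOf x) (arcOf y) → Adj G x y)
    proper   : ∀ x y → ¬ ArcProperlyContains (arcOf x) (arcOf y)

IsPCA : ∀ {V} → Graph V → Set
IsPCA G = PCAModel G

record Interval : Set where
  constructor ⟦_,_⟧
  field
    lo hi : ℕ

IntervalsIntersect : Interval → Interval → Set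
IntervalsIntersect ⟦ a , b ⟧ ⟦ c , d ⟧ = a ≤ d × c ≤ b

IntervalContains : Interval → Interval → Set
IntervalContains ⟦ a , b ⟧ ⟦ c , d ⟧ = a ≤ c × d ≤ b

IntervalProperlyContains : Interval → Interval → Set
IntervalProperlyContains I J = IntervalContains I J × ¬ IntervalContains J I

record ProperIntervalModel {V} (G : Graph V) : Set where
  field
    ivOf     : V → Interval
    wf       : ∀ x → Interval.lo (ivOf x) ≤ Interval.hi (ivOf x)
    model    : ∀ x y → x ≢ y → (Adj G x y → IntervalsIntersect (ivOf x) (ivOf y))
                               × (IntervalsIntersect (ivOf x) (ivOf y) → Adj G x y)
    proper   : ∀ x y → ¬ IntervalProperlyContains (ivOf x) (ivOf y)

IsProperInterval : ∀ {V} → Graph V → Set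
IsProperInterval G = ProperIntervalModel G

{-# OPTIONS --safe #-}
-- If v had a non-neighbour u in G ∪ {vw}, then u would join v to the co-connected
-- G ∖ {v} in the complement, so v is universal in G ∪ {vw}.  In a proper circular-arc
-- model with a universal vertex v, the arcs through the first point of the arc of v
-- form a clique, and every other arc meets the arc of v without containing its first
-- point, so by properness it contains its last point: these form a clique too, and
-- G ∪ {vw} is co-bipartite.  Removing vw, v becomes adjacent in the complement to w
-- alone, so colouring v opposite to w makes G co-bipartite.
module Submission where

open import Data.Nat using (ℕ; _+_; _∸_; _%_; _≤_; _<_; _≤?_; _<?_; z≤n; NonZero)
open import Data.Nat.Properties
  using (+-comm; +-assoc; +-∸-assoc; m+n∸m≡n; m+[n∸m]≡n; m∸n+n≡m; m<n+o⇒m∸n<o; m+n≡0⇒n≡0; m+n≮n; m≤m+n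
        ; ≮⇒≥; ≰⇒>; <⇒≤; <-irrefl; ≤-<-trans; +-mono-<; +-mono-≤-<; +-monoʳ-<; +-monoʳ-≤; +-cancelˡ-≤; module ≤-Reasoning)
open import Data.Nat.DivMod using (m%n<n; m<n⇒m%n≡m; m≤n⇒[n∸m]%m≡n%m; [m+n]%n≡m%n; %-distribˡ-+; n%n≡0; m%n%n≡m%n)
open import Data.Nat.Tactic.RingSolver using (solve-∀)
open import Data.Fin using (Fin; toℕ; fromℕ<; _≟_)
open import Data.Fin.Properties using (toℕ≤n; toℕ-fromℕ<; any?)
open import Data.Bool using (Bool; not; if_then_else_)
open import Data.Bool.Properties using (not-¬)
open import Data.Sum using (_⊎_; inj₁; inj₂)
open import Data.Product using (_×_; _,_; proj₁; proj₂)
open import Function using (_∘_)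
open import Relation.Nullary using (¬_; Dec; yes; no; does; contradiction)
open import Relation.Nullary.Decidable using (_×-dec_; map′; decidable-stable)
open import Relation.Binary.Definitions using (DecidableEquality)
open import Relation.Binary.Construct.Closure.ReflexiveTransitive using (Star; ε; _◅_; _◅◅_; reverse; map)
open import Relation.Binary.PropositionalEquality
open import Defs hiding (sym)

module _ {L : ℕ} .{{_ : NonZero L}} where

  -- p ∈Arc arc s ℓ unfolds to dist s p ≤ ℓ.
  dist : Fin L → Fin L → ℕ
  dist s t = (toℕ t + L ∸ toℕ s) % L

  dist<L : ∀ s t → dist s t < L
  dist<L s t = m%n<n _ L

  +L∸ : ∀ x (s : Fin L) → x + L ∸ toℕ s ≡ x + (L ∸ toℕ s)
  +L∸ x s = +-∸-assoc x (toℕ≤n s)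

  dist-self : ∀ s → dist s s ≡ 0
  dist-self s = trans (cong (_% L) (m+n∸m≡n (toℕ s) L)) (n%n≡0 L)

  dist-sum-mod : ∀ s t p → dist s p ≡ (dist s t + dist t p) % L
  dist-sum-mod s t p = begin
    (toℕ p + L ∸ toℕ s) % L                                  ≡˘⟨ [m+n]%n≡m%n _ L ⟩
    (toℕ p + L ∸ toℕ s + L) % L                              ≡⟨ cong (_% L) sums ⟩
    ((toℕ t + L ∸ toℕ s) + (toℕ p + L ∸ toℕ t)) % L          ≡⟨ %-distribˡ-+ _ _ L ⟩
    (dist s t + dist t p) % L                                ∎
    where
    open ≡-Reasoning
    commute : ∀ t p a b → (p + a) + (t + b) ≡ (t + a) + (p + b)
    commute = solve-∀
    sums : toℕ p + L ∸ toℕ s + L ≡ (toℕ t + L ∸ toℕ s) + (toℕ p + L ∸ toℕ t)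
    sums = begin
      toℕ p + L ∸ toℕ s + L                                  ≡⟨ cong₂ _+_ (+L∸ (toℕ p) s) (sym (m+[n∸m]≡n (toℕ≤n t))) ⟩
      (toℕ p + (L ∸ toℕ s)) + (toℕ t + (L ∸ toℕ t))          ≡⟨ commute (toℕ t) (toℕ p) _ _ ⟩
      (toℕ t + (L ∸ toℕ s)) + (toℕ p + (L ∸ toℕ t))          ≡˘⟨ cong₂ _+_ (+L∸ (toℕ t) s) (+L∸ (toℕ p) t) ⟩
      (toℕ t + L ∸ toℕ s) + (toℕ p + L ∸ toℕ t)              ∎

  dist-triangle : ∀ s t p → dist s t + dist t p ≡ dist s p ⊎ dist s t + dist t p ≡ dist s p + L
  dist-triangle s t p with dist s t + dist t p <? L
  ... | yes short = inj₁ (sym (trans (dist-sum-mod s t p) (m<n⇒m%n≡m short)))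
  ... | no long = inj₂ (begin
    x              ≡˘⟨ m∸n+n≡m L≤x ⟩
    x ∸ L + L      ≡˘⟨ cong (_+ L) wrapped ⟩
    dist s p + L   ∎)
    where
    open ≡-Reasoning
    x = dist s t + dist t p
    L≤x : L ≤ x
    L≤x = ≮⇒≥ long
    wrapped : dist s p ≡ x ∸ L
    wrapped = begin
      dist s p       ≡⟨ dist-sum-mod s t p ⟩
      x % L          ≡˘⟨ m≤n⇒[n∸m]%m≡n%m L≤x ⟩
      (x ∸ L) % L    ≡⟨ m<n⇒m%n≡m (m<n+o⇒m∸n<o x L (+-mono-< (dist<L s t) (dist<L t p))) ⟩
      x ∸ L          ∎

  dist-via : ∀ s t p → dist s t + dist t p < L → dist s t + dist t p ≡ dist s p
  dist-via s t p short with dist-triangle s t p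
  ... | inj₁ eq = eq
  ... | inj₂ eq = contradiction (subst (_< L) eq short) (m+n≮n (dist s p) L)

  dist-split : ∀ s t p → dist s t ≤ dist s p → dist s t + dist t p ≡ dist s p
  dist-split s t p t≤p with dist-triangle s t p
  ... | inj₁ eq = eq
  ... | inj₂ eq = contradiction (subst (_< dist s p + L) eq (+-mono-≤-< t≤p (dist<L t p)))
                                (<-irrefl refl)

  lastPoint : Arc L → Fin L
  lastPoint (arc s ℓ) = fromℕ< (m%n<n (toℕ s + ℓ) L)

  dist-lastPoint : ∀ s ℓ → ℓ < L → dist s (lastPoint (arc s ℓ)) ≡ ℓ
  dist-lastPoint s ℓ ℓ<L = begin
    (toℕ (fromℕ< _) + L ∸ toℕ s) % L         ≡⟨ cong (λ z → (z + L ∸ toℕ s) % L) (toℕ-fromℕ< _) ⟩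
    ((toℕ s + ℓ) % L + L ∸ toℕ s) % L        ≡⟨ cong (_% L) (+L∸ ((toℕ s + ℓ) % L) s) ⟩
    ((toℕ s + ℓ) % L + (L ∸ toℕ s)) % L      ≡⟨ %-distribˡ-+ _ _ L ⟩
    ((toℕ s + ℓ) % L % L + (L ∸ toℕ s) % L) % L  ≡⟨ cong (λ z → (z + (L ∸ toℕ s) % L) % L) (m%n%n≡m%n _ L) ⟩
    ((toℕ s + ℓ) % L + (L ∸ toℕ s) % L) % L  ≡˘⟨ %-distribˡ-+ _ _ L ⟩
    (toℕ s + ℓ + (L ∸ toℕ s)) % L            ≡⟨ cong (_% L) around ⟩
    (ℓ + L) % L                              ≡⟨ [m+n]%n≡m%n ℓ L ⟩
    ℓ % L                                    ≡⟨ m<n⇒m%n≡m ℓ<L ⟩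
    ℓ                                        ∎
    where
    open ≡-Reasoning
    around : toℕ s + ℓ + (L ∸ toℕ s) ≡ ℓ + L
    around = begin
      toℕ s + ℓ + (L ∸ toℕ s)    ≡⟨ cong (_+ (L ∸ toℕ s)) (+-comm (toℕ s) ℓ) ⟩
      ℓ + toℕ s + (L ∸ toℕ s)    ≡⟨ +-assoc ℓ (toℕ s) _ ⟩
      ℓ + (toℕ s + (L ∸ toℕ s))  ≡⟨ cong (ℓ +_) (m+[n∸m]≡n (toℕ≤n s)) ⟩
      ℓ + L                      ∎

  start-∈ : ∀ s ℓ → s ∈Arc arc s ℓ
  start-∈ s ℓ = subst (_≤ ℓ) (sym (dist-self s)) z≤n

  ∉⇒dist+len<L : ∀ {s t m} → ¬ (s ∈Arc arc t m) → dist s t + m < L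
  ∉⇒dist+len<L {s} {t} {m} s∉ with dist-triangle s t s
  ... | inj₁ eq = contradiction (subst (_≤ m) (sym (m+n≡0⇒n≡0 (dist s t) (trans eq (dist-self s)))) z≤n) s∉
  ... | inj₂ eq = begin-strict
    dist s t + m         <⟨ +-monoʳ-< (dist s t) (≰⇒> s∉) ⟩
    dist s t + dist t s  ≡⟨ trans eq (cong (_+ L) (dist-self s)) ⟩
    L                    ∎
    where open ≤-Reasoning

  lastPoint-∈ : ∀ A B → ¬ (Arc.start A ∈Arc B) → ArcsIntersect A B
              → ¬ ArcProperlyContains A B → lastPoint A ∈Arc B
  lastPoint-∈ (arc s ℓ) (arc t m) s∉B (q , q∈A , q∈B) ¬A⊃B = +-cancelˡ-≤ (dist s t) _ _ (begin
    dist s t + dist t P  ≡⟨ dist-split s t P t≤P ⟩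
    dist s P             ≡⟨ dist-lastPoint s ℓ ℓ<L ⟩
    ℓ                    ≤⟨ ℓ≤ ⟩
    dist s t + m         ∎)
    where
    open ≤-Reasoning
    P = lastPoint (arc s ℓ)
    short : dist s t + m < L
    short = ∉⇒dist+len<L {s} {t} s∉B
    via : ∀ {p} → p ∈Arc arc t m → dist s t + dist t p ≡ dist s p
    via {p} p∈B = dist-via s t p (≤-<-trans (+-monoʳ-≤ (dist s t) p∈B) short)
    ℓ≤ : ℓ ≤ dist s t + m
    ℓ≤ = ≮⇒≥ λ long → ¬A⊃B
      ( (λ p p∈B → <⇒≤ (≤-<-trans (subst (_≤ dist s t + m) (via p∈B) (+-monoʳ-≤ (dist s t) p∈B)) long))
      , λ B⊇A → s∉B (B⊇A s (start-∈ s ℓ)) )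
    ℓ<L : ℓ < L
    ℓ<L = ≤-<-trans ℓ≤ short
    t≤P : dist s t ≤ dist s P
    t≤P = begin
      dist s t             ≤⟨ m≤m+n (dist s t) (dist t q) ⟩
      dist s t + dist t q  ≡⟨ via q∈B ⟩
      dist s q             ≤⟨ q∈A ⟩
      ℓ                    ≡˘⟨ dist-lastPoint s ℓ ℓ<L ⟩
      dist s P             ∎

arcsIntersect? : ∀ {L} .{{_ : NonZero L}} (A B : Arc L) → Dec (ArcsIntersect A B)
arcsIntersect? A B = any? λ p → (_ ≤? _) ×-dec (_ ≤? _)

module _ {V : Set} {G : Graph V} (M : PCAModel G) where
  open PCAModel M

  adj? : ∀ {x y} → x ≢ y → Dec (Adj G x y)
  adj? {x} {y} x≢y =
    map′ (proj₂ (model x y x≢y)) (proj₁ (model x y x≢y)) (arcsIntersect? (arcOf x) (arcOf y))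

  universal⇒coBipartite : ∀ {v} → Universal G v → CoBipartite G
  universal⇒coBipartite {v} v-universal = colour , separated
    where
    S = Arc.start (arcOf v)

    S∈? : ∀ x → Dec (S ∈Arc arcOf x)
    S∈? x = _ ≤? _

    colour : V → Bool
    colour x = does (S∈? x)

    reachesEnd : ∀ {x} → ¬ (S ∈Arc arcOf x) → lastPoint (arcOf v) ∈Arc arcOf x
    reachesEnd {x} S∉x = lastPoint-∈ (arcOf v) (arcOf x) S∉x
                           (proj₁ (model v x v≢x) (Graph.sym G (v-universal x x≢v))) (proper v x)
      where
      x≢v : x ≢ v
      x≢v refl = S∉x (start-∈ S (Arc.len (arcOf v)))
      v≢x : v ≢ x
      v≢x = x≢v ∘ sym

    sameSide⇒adjacent : ∀ {x y} → x ≢ y → (S∈x : Dec (S ∈Arc arcOf x)) (S∈y : Dec (S ∈Arc arcOf y))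
                      → does S∈x ≡ does S∈y → Adj G x y
    sameSide⇒adjacent {x} {y} x≢y (yes S∈x) (yes S∈y) _ = proj₂ (model x y x≢y) (S , S∈x , S∈y)
    sameSide⇒adjacent {x} {y} x≢y (no S∉x)  (no S∉y)  _ =
      proj₂ (model x y x≢y) (_ , reachesEnd S∉x , reachesEnd S∉y)
    sameSide⇒adjacent _ (yes _) (no _)  ()
    sameSide⇒adjacent _ (no _)  (yes _) ()

    separated : ∀ {x y} → Adj (complement G) x y → colour x ≢ colour y
    separated {x} {y} (x≢y , ¬xy) = ¬xy ∘ sameSide⇒adjacent x≢y (S∈? x) (S∈? y)

module _ {V : Set} (_≟_ : DecidableEquality V) (G : Graph V) (v : V) where

  complementPath-deleteVertex : ∀ {a b} → Star (Adj (complement (deleteVertex G v))) a b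
                              → Star (Adj (complement G)) (proj₁ a) (proj₁ b)
  complementPath-deleteVertex ε = ε
  complementPath-deleteVertex {a} (_◅_ {j = b} (_ , ¬ab) path) with proj₁ a ≟ proj₁ b
  ... | yes refl = complementPath-deleteVertex path
  ... | no a≢b   = (a≢b , ¬ab) ◅ complementPath-deleteVertex path

  nonNeighbour⇒coConnected : CoConnected (deleteVertex G v) → ∀ {u} → u ≢ v → ¬ Adj G u v → CoConnected G
  nonNeighbour⇒coConnected cc {u} u≢v ¬uv x y = toU x ◅◅ reverse (Graph.sym (complement G)) (toU y)
    where
    toU : ∀ x → Star (Adj (complement G)) x u
    toU x with x ≟ v
    ... | yes refl = (u≢v ∘ sym , ¬uv ∘ Graph.sym G) ◅ ε
    ... | no x≢v   = complementPath-deleteVertex (cc (x , x≢v) (u , u≢v))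

  ¬coConnected⇒universal : (∀ {x y} → x ≢ y → Dec (Adj G x y)) → CoConnected (deleteVertex G v)
                         → ¬ CoConnected G → Universal G v
  ¬coConnected⇒universal adj? cc ¬cc u u≢v =
    decidable-stable (adj? u≢v) (¬cc ∘ nonNeighbour⇒coConnected cc u≢v)

module _ {V : Set} (G : Graph V) (v w : V) (v≢w : v ≢ w) where

  ¬Adj-addEdge : ∀ {x y} → x ≢ v → y ≢ v → ¬ Adj G x y → ¬ Adj (addEdge G v w v≢w) x y
  ¬Adj-addEdge x≢v y≢v ¬xy (inj₁ xy)               = ¬xy xy
  ¬Adj-addEdge x≢v y≢v ¬xy (inj₂ (inj₁ (x≡v , _))) = x≢v x≡v
  ¬Adj-addEdge x≢v y≢v ¬xy (inj₂ (inj₂ (_ , y≡v))) = y≢v y≡v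

  coConnected-deleteVertex-addEdge : CoConnected (deleteVertex G v)
                                   → CoConnected (deleteVertex (addEdge G v w v≢w) v)
  coConnected-deleteVertex-addEdge cc a b = map step (cc a b)
    where
    step : ∀ {a b} → Adj (complement (deleteVertex G v)) a b
         → Adj (complement (deleteVertex (addEdge G v w v≢w) v)) a b
    step {_ , a≢v} {_ , b≢v} (a≢b , ¬ab) = a≢b , ¬Adj-addEdge a≢v b≢v ¬ab

  universal-addEdge⇒nonNeighbour≡ : Universal (addEdge G v w v≢w) v → ∀ {y} → y ≢ v → ¬ Adj G y v → y ≡ w
  universal-addEdge⇒nonNeighbour≡ universal {y} y≢v ¬yv with universal y y≢v
  ... | inj₁ yv               = contradiction yv ¬yv
  ... | inj₂ (inj₁ (y≡v , _)) = contradiction y≡v y≢v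
  ... | inj₂ (inj₂ (y≡w , _)) = y≡w

  coBipartite-removeEdge : DecidableEquality V → Universal (addEdge G v w v≢w) v
                         → CoBipartite (addEdge G v w v≢w) → CoBipartite G
  coBipartite-removeEdge _≟_ universal (colour , separated) = colour′ , separated′
    where
    colour′ : V → Bool
    colour′ x = if does (x ≟ v) then not (colour w) else colour x

    nonNeighbour≡ = universal-addEdge⇒nonNeighbour≡ universal

    separated′ : ∀ {x y} → Adj (complement G) x y → colour′ x ≢ colour′ y
    separated′ {x} {y} (x≢y , ¬xy) with x ≟ v | y ≟ v
    ... | yes refl | yes refl = contradiction refl x≢y
    ... | yes refl | no y≢v with nonNeighbour≡ y≢v (¬xy ∘ Graph.sym G)
    ...   | refl = not-¬ refl ∘ sym
    separated′ {x} {y} (x≢y , ¬xy) | no x≢v | yes refl with nonNeighbour≡ x≢v ¬xy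
    ...   | refl = not-¬ refl
    separated′ {x} {y} (x≢y , ¬xy) | no x≢v | no y≢v =
      separated (x≢y , ¬Adj-addEdge x≢v y≢v ¬xy)

lemma40 : ∀ {n : ℕ} (G : Graph (Fin n)) (v w : Fin n) (v≢w : v ≢ w)
          → ¬ Adj G v w
          → IsPCA G
          → IsPCA (addEdge G v w v≢w)
          → ¬ IsProperInterval (addEdge G v w v≢w)
          → ¬ CoConnected (addEdge G v w v≢w)
          → CoConnected (deleteVertex G v)
          → Universal (addEdge G v w v≢w) v × CoBipartite G
lemma40 G v w v≢w _ _ M _ ¬coConnected coConnected-G∖v =
  v-universal , coBipartite-removeEdge G v w v≢w _≟_ v-universal (universal⇒coBipartite M v-universal)
  where
  v-universal : Universal (addEdge G v w v≢w) v
  v-universal = ¬coConnected⇒universal _≟_ (addEdge G v w v≢w) v (adj? M)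
                  (coConnected-deleteVertex-addEdge G v w v≢w coConnected-G∖v) ¬coConnected
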